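{- Let $p$ be an odd prime and let $k$ be a positive integer. Define \[ A=\sum_{0\le i\le(p-1)/2}(-1)^{\left(i+\frac{p-1}{2}\right)}\frac{p}{2i+1}\binom{i+\frac{p-1}{2}}{2i}k^{2i+1}. \] Then the polynomial $P(p,A)=x^{2p}-Ax^p+1$ is reducible. More precisely, \[ x^{2p}-Ax^p+1=(x^2-kx+1)\cdot Q(k,p), \] where $Q(k,p)$ is a palindromic polynomial in $x$ whose coefficients all lie in the set of values of the sequence $(a_i)_{i\ge1}$ defined by $a_1=0$, $a_2=1$, $a_{i+2}=ka_{i+1}-a_i$.
   Context: A polynomial is palindromic if its coefficient sequence reads the same forwards and backwards. Reducibility refers to factorization into nonconstant polynomials with integer (equivalently rational) coefficients. -}

module Defs where

open import Data.Nat as ℕ using (ℕ; zero; suc; _∸_)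
open import Data.Nat.Combinatorics using (_C_)
open import Data.Nat.Primality using (Prime)
open import Data.Integer as ℤ using (ℤ; +_; -[1+_])
open import Data.Rational as ℚ using (ℚ; _/_)
open import Data.List using (List; []; _∷_; map; _++_; replicate; reverse; foldr)
open import Data.List.Membership.Propositional using (_∈_)
open import Data.Product using (Σ; ∃; _×_; _,_)
open import Relation.Binary.PropositionalEquality using (_≡_)

-- Polynomials with integer coefficients as coefficient lists,
-- constant term first.
Poly : Set
Poly = List ℤ

polyAdd : Poly → Poly → Poly
polyAdd []       g        = g
polyAdd (a ∷ f)  []       = a ∷ f
polyAdd (a ∷ f)  (b ∷ g)  = (a ℤ.+ b) ∷ polyAdd f g

polyMul : Poly → Poly → Poly
polyMul []      g = []
polyMul (a ∷ f) g = polyAdd (map (a ℤ.*_) g) (+ 0 ∷ polyMul f g)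

Palindromic : Poly → Set
Palindromic f = reverse f ≡ f

sgn : ℕ → ℤ
sgn zero          = + 1
sgn (suc zero)    = -[1+ 0 ]
sgn (suc (suc n)) = sgn n

-- a₁ = 0, a₂ = 1, a_{i+2} = k a_{i+1} - a_i  (a k 0 is an unused junk value)
seqA : ℤ → ℕ → ℤ
seqA k zero                = + 0
seqA k (suc zero)          = + 0
seqA k (suc (suc zero))    = + 1
seqA k (suc (suc (suc n))) = k ℤ.* seqA k (suc (suc n)) ℤ.- seqA k (suc n)

sumUpTo : ℕ → (ℕ → ℚ) → ℚ
sumUpTo zero    f = f 0
sumUpTo (suc m) f = sumUpTo m f ℚ.+ f (suc m)

fromℤ : ℤ → ℚ
fromℤ z = z / 1

Aval : ℕ → ℕ → ℚ
Aval p k = sumUpTo h term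
  where
  h = (p ∸ 1) ℕ./ 2
  term : ℕ → ℚ
  term i = fromℤ (sgn (i ℕ.+ h))
           ℚ.* ((+ p) / suc (2 ℕ.* i))
           ℚ.* fromℤ (+ ((i ℕ.+ h) C (2 ℕ.* i)))
           ℚ.* fromℤ (+ (k ℕ.^ (2 ℕ.* i ℕ.+ 1)))

-- coefficient list of x^(2p) - A x^p + 1
targetPoly : ℕ → ℤ → Poly
targetPoly p A =
  (+ 1 ∷ replicate (p ∸ 1) (+ 0)) ++ (ℤ.- A ∷ replicate (p ∸ 1) (+ 0)) ++ (+ 1 ∷ [])

quadPoly : ℤ → Poly
quadPoly k = + 1 ∷ ℤ.- k ∷ + 1 ∷ []

{-# OPTIONS --safe #-}
-- Let w n = a (n + 1), so w 0 = 0, w 1 = 1 and w (n + 2) = k · w (n + 1) − w n. In the product of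
-- x² − k x + 1 with the palindrome w 1, …, w p, …, w 1 every coefficient other than those of 1, x^p
-- and x^(2p) is an instance of the recurrence and vanishes; that of x^p is −(w (p + 1) − w (p − 1)).
-- For p = 2h + 1 the absorption identities give p / (2i + 1) · C(i + h, 2i) = C(i + h + 1, 2i + 1)
-- + C(i + h, 2i + 1), splitting A into two signed binomial sums. Together with the sum of the
-- (−1)^(i + h) C(i + h, 2i) k^(2i), Pascal's rule makes them satisfy the recurrence of w in h,
-- so they equal w (2h + 2) and −w (2h).
module Submission where

open import Defs
open import Function using (_∘_)
open import Data.Empty using (⊥-elim)
open import Data.Sum using (_⊎_; inj₁; inj₂)
open import Data.Product using (Σ; ∃; _×_; _,_)
open import Data.Nat as ℕ using (ℕ; zero; suc; NonZero; _<_; _⊔_)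
import Data.Nat.Properties as ℕₚ
import Data.Nat.Tactic.RingSolver as ℕ-Solver
open import Data.Nat.Combinatorics using (_C_; nC1≡n; k>n⇒nCk≡0) renaming (nCk+nC[k+1]≡[n+1]C[k+1] to pascal)
open import Data.Nat.DivMod using (m*n/n≡m)
open import Data.Nat.Divisibility using (divides)
open import Data.Nat.Primality using (Prime; prime⇒irreducible)
open import Data.Integer using (ℤ; +_; -_; _+_; _-_; _*_; _^_)
import Data.Integer.Properties as ℤₚ
open import Data.Integer.Tactic.RingSolver using (solve-∀)
open import Data.Rational as ℚ using (ℚ; _/_)
import Data.Rational.Properties as ℚₚ
open import Data.Rational.Unnormalised as ℚᵘ using (mkℚᵘ; *≡*)
import Data.Rational.Unnormalised.Properties as ℚᵘₚ
open import Data.List using ([]; _∷_; [_]; _∷ʳ_; map; _++_; replicate; reverse; length; applyUpTo; applyDownFrom)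
open import Data.List.Properties using (length-map; unfold-reverse; reverse-++; reverse-involutive; ++-assoc; applyUpTo-∷ʳ)
open import Data.List.Relation.Unary.All using (All)
open import Data.List.Relation.Unary.All.Properties using (++⁺; applyUpTo⁺₂; applyDownFrom⁺₂)
open import Relation.Binary.PropositionalEquality using (_≡_; _≢_; refl; sym; trans; cong; cong₂; subst; module ≡-Reasoning)
open ≡-Reasoning

coeff : Poly → ℕ → ℤ
coeff []      n       = + 0
coeff (a ∷ f) zero    = a
coeff (a ∷ f) (suc n) = coeff f n

coeff-injective : ∀ {f g} → length f ≡ length g → (∀ n → coeff f n ≡ coeff g n) → f ≡ g
coeff-injective {[]}    {[]}    _   _  = refl
coeff-injective {a ∷ f} {b ∷ g} len eq =
  cong₂ _∷_ (eq 0) (coeff-injective (ℕₚ.suc-injective len) (eq ∘ suc))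

coeff-polyAdd : ∀ f g n → coeff (polyAdd f g) n ≡ coeff f n + coeff g n
coeff-polyAdd []      g       n       = sym (ℤₚ.+-identityˡ _)
coeff-polyAdd (a ∷ f) []      n       = sym (ℤₚ.+-identityʳ _)
coeff-polyAdd (a ∷ f) (b ∷ g) zero    = refl
coeff-polyAdd (a ∷ f) (b ∷ g) (suc n) = coeff-polyAdd f g n

coeff-map-* : ∀ a f n → coeff (map (a *_) f) n ≡ a * coeff f n
coeff-map-* a []      n       = sym (ℤₚ.*-zeroʳ a)
coeff-map-* a (b ∷ f) zero    = refl
coeff-map-* a (b ∷ f) (suc n) = coeff-map-* a f n

coeff-polyMul-∷ : ∀ a f g n → coeff (polyMul (a ∷ f) g) n ≡ a * coeff g n + coeff (+ 0 ∷ polyMul f g) n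
coeff-polyMul-∷ a f g n = trans (coeff-polyAdd (map (a *_) g) _ n) (cong (_+ _) (coeff-map-* a g n))

coeff-[0] : ∀ n → coeff [ + 0 ] n ≡ + 0
coeff-[0] zero    = refl
coeff-[0] (suc n) = refl

length-polyAdd : ∀ f g → length (polyAdd f g) ≡ length f ⊔ length g
length-polyAdd []      g       = refl
length-polyAdd (a ∷ f) []      = refl
length-polyAdd (a ∷ f) (b ∷ g) = cong suc (length-polyAdd f g)

length-polyMul : ∀ a f b g → length (polyMul (a ∷ f) (b ∷ g)) ≡ suc (length f ℕ.+ length g)
length-polyMul a f b g = begin
  length (polyMul (a ∷ f) (b ∷ g))
    ≡⟨ length-polyAdd (map (a *_) (b ∷ g)) (+ 0 ∷ polyMul f (b ∷ g)) ⟩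
  suc (length (map (a *_) g)) ⊔ suc (length (polyMul f (b ∷ g)))
    ≡⟨ cong (λ n → suc n ⊔ suc (length (polyMul f (b ∷ g)))) (length-map (a *_) g) ⟩
  suc (length g ⊔ length (polyMul f (b ∷ g)))
    ≡⟨ cong suc (shifted f) ⟩
  suc (length f ℕ.+ length g) ∎
  where
  shifted : ∀ f → length g ⊔ length (polyMul f (b ∷ g)) ≡ length f ℕ.+ length g
  shifted []      = ℕₚ.⊔-identityʳ (length g)
  shifted (c ∷ f) = trans (cong (length g ⊔_) (length-polyMul c f b g))
                          (ℕₚ.m≤n⇒m⊔n≡n (ℕₚ.m≤n⇒m≤1+n (ℕₚ.m≤n+m (length g) (length f))))

reverse-applyDownFrom : ∀ {A : Set} (f : ℕ → A) n → reverse (applyDownFrom f n) ≡ applyUpTo f n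
reverse-applyDownFrom f zero    = refl
reverse-applyDownFrom f (suc n) = begin
  reverse (f n ∷ applyDownFrom f n)    ≡⟨ unfold-reverse (f n) (applyDownFrom f n) ⟩
  reverse (applyDownFrom f n) ∷ʳ f n   ≡⟨ cong (_∷ʳ f n) (reverse-applyDownFrom f n) ⟩
  applyUpTo f n ∷ʳ f n                 ≡⟨ applyUpTo-∷ʳ f n ⟩
  applyUpTo f (suc n)                  ∎

applyUpTo-++-applyDownFrom-palindromic : ∀ (f : ℕ → ℤ) n → Palindromic (applyUpTo f (suc n) ++ applyDownFrom f n)
applyUpTo-++-applyDownFrom-palindromic f n = begin
  reverse (applyUpTo f (suc n) ++ applyDownFrom f n)
    ≡⟨ reverse-++ (applyUpTo f (suc n)) (applyDownFrom f n) ⟩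
  reverse (applyDownFrom f n) ++ reverse (applyUpTo f (suc n))
    ≡⟨ cong₂ _++_ (reverse-applyDownFrom f n) reverse-applyUpTo ⟩
  applyUpTo f n ++ applyDownFrom f (suc n)
    ≡⟨ ++-assoc (applyUpTo f n) [ f n ] (applyDownFrom f n) ⟨
  (applyUpTo f n ∷ʳ f n) ++ applyDownFrom f n
    ≡⟨ cong (_++ applyDownFrom f n) (applyUpTo-∷ʳ f n) ⟩
  applyUpTo f (suc n) ++ applyDownFrom f n ∎
  where
  reverse-applyUpTo : reverse (applyUpTo f (suc n)) ≡ applyDownFrom f (suc n)
  reverse-applyUpTo = trans (cong reverse (sym (reverse-applyDownFrom f (suc n))))
                            (reverse-involutive (applyDownFrom f (suc n)))

replicate-++-∷ : ∀ {A : Set} n (x : A) xs → replicate n x ++ x ∷ xs ≡ x ∷ replicate n x ++ xs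
replicate-++-∷ zero    x xs = refl
replicate-++-∷ (suc n) x xs = cong (x ∷_) (replicate-++-∷ n x xs)

[1+k]*[1+n]C[1+k]≡[1+n]*nCk : ∀ n k → suc k ℕ.* (suc n C suc k) ≡ suc n ℕ.* (n C k)
[1+k]*[1+n]C[1+k]≡[1+n]*nCk zero    zero    = refl
[1+k]*[1+n]C[1+k]≡[1+n]*nCk zero    (suc k) = ℕₚ.*-zeroʳ (suc (suc k))
[1+k]*[1+n]C[1+k]≡[1+n]*nCk (suc n) zero    =
  trans (ℕₚ.+-identityʳ _) (trans (nC1≡n (suc (suc n))) (sym (ℕₚ.*-identityʳ (suc (suc n)))))
[1+k]*[1+n]C[1+k]≡[1+n]*nCk (suc n) (suc k) = begin
  suc (suc k) ℕ.* (suc (suc n) C suc (suc k))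
    ≡⟨ cong (suc (suc k) ℕ.*_) (pascal (suc n) (suc k)) ⟨
  suc (suc k) ℕ.* (X′ ℕ.+ suc n C suc (suc k))
    ≡⟨ ℕₚ.*-distribˡ-+ (suc (suc k)) X′ _ ⟩
  (X′ ℕ.+ suc k ℕ.* X′) ℕ.+ suc (suc k) ℕ.* (suc n C suc (suc k))
    ≡⟨ cong₂ (λ a b → (X′ ℕ.+ a) ℕ.+ b) ([1+k]*[1+n]C[1+k]≡[1+n]*nCk n k)
                                        ([1+k]*[1+n]C[1+k]≡[1+n]*nCk n (suc k)) ⟩
  (X′ ℕ.+ suc n ℕ.* (n C k)) ℕ.+ suc n ℕ.* (n C suc k)
    ≡⟨ ℕₚ.+-assoc X′ _ _ ⟩
  X′ ℕ.+ (suc n ℕ.* (n C k) ℕ.+ suc n ℕ.* (n C suc k))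
    ≡⟨ cong (X′ ℕ.+_) (ℕₚ.*-distribˡ-+ (suc n) (n C k) (n C suc k)) ⟨
  X′ ℕ.+ suc n ℕ.* (n C k ℕ.+ n C suc k)
    ≡⟨ cong (λ a → X′ ℕ.+ suc n ℕ.* a) (pascal n k) ⟩
  suc (suc n) ℕ.* X′ ∎
  where
  X′ = suc n C suc k

[1+k]*nC[1+k]+k*nCk≡n*nCk : ∀ n k → suc k ℕ.* (n C suc k) ℕ.+ k ℕ.* (n C k) ≡ n ℕ.* (n C k)
[1+k]*nC[1+k]+k*nCk≡n*nCk zero    zero    = refl
[1+k]*nC[1+k]+k*nCk≡n*nCk zero    (suc k) = cong₂ ℕ._+_ (ℕₚ.*-zeroʳ (suc (suc k))) (ℕₚ.*-zeroʳ (suc k))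
[1+k]*nC[1+k]+k*nCk≡n*nCk (suc n) zero    = trans (ℕₚ.+-identityʳ _) ([1+k]*[1+n]C[1+k]≡[1+n]*nCk n 0)
[1+k]*nC[1+k]+k*nCk≡n*nCk (suc n) (suc k) = begin
  suc (suc k) ℕ.* (suc n C suc (suc k)) ℕ.+ suc k ℕ.* (suc n C suc k)
    ≡⟨ cong₂ ℕ._+_ ([1+k]*[1+n]C[1+k]≡[1+n]*nCk n (suc k)) ([1+k]*[1+n]C[1+k]≡[1+n]*nCk n k) ⟩
  suc n ℕ.* (n C suc k) ℕ.+ suc n ℕ.* (n C k)
    ≡⟨ ℕₚ.*-distribˡ-+ (suc n) (n C suc k) (n C k) ⟨
  suc n ℕ.* (n C suc k ℕ.+ n C k)
    ≡⟨ cong (suc n ℕ.*_) (trans (ℕₚ.+-comm (n C suc k) (n C k)) (pascal n k)) ⟩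
  suc n ℕ.* (suc n C suc k) ∎

binomial-split : ∀ h i → suc (2 ℕ.* h) ℕ.* ((i ℕ.+ h) C (2 ℕ.* i))
                       ≡ suc (2 ℕ.* i) ℕ.* (suc (i ℕ.+ h) C suc (2 ℕ.* i) ℕ.+ (i ℕ.+ h) C suc (2 ℕ.* i))
binomial-split h i = ℕₚ.+-cancelʳ-≡ (k ℕ.* X) _ _ (begin
  suc (2 ℕ.* h) ℕ.* X ℕ.+ k ℕ.* X
    ≡⟨ weights h i X ⟩
  suc n ℕ.* X ℕ.+ n ℕ.* X
    ≡⟨ cong₂ ℕ._+_ ([1+k]*[1+n]C[1+k]≡[1+n]*nCk n k) ([1+k]*nC[1+k]+k*nCk≡n*nCk n k) ⟨
  suc k ℕ.* (suc n C suc k) ℕ.+ (suc k ℕ.* (n C suc k) ℕ.+ k ℕ.* X)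
    ≡⟨ ℕₚ.+-assoc (suc k ℕ.* (suc n C suc k)) _ _ ⟨
  suc k ℕ.* (suc n C suc k) ℕ.+ suc k ℕ.* (n C suc k) ℕ.+ k ℕ.* X
    ≡⟨ cong (ℕ._+ k ℕ.* X) (ℕₚ.*-distribˡ-+ (suc k) (suc n C suc k) (n C suc k)) ⟨
  suc k ℕ.* (suc n C suc k ℕ.+ n C suc k) ℕ.+ k ℕ.* X ∎)
  where
  n = i ℕ.+ h
  k = 2 ℕ.* i
  X = n C k
  weights : ∀ h i X → suc (2 ℕ.* h) ℕ.* X ℕ.+ 2 ℕ.* i ℕ.* X ≡ suc (i ℕ.+ h) ℕ.* X ℕ.+ (i ℕ.+ h) ℕ.* X
  weights = ℕ-Solver.solve-∀

sumUpToℤ : ℕ → (ℕ → ℤ) → ℤ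
sumUpToℤ zero    f = f 0
sumUpToℤ (suc m) f = sumUpToℤ m f + f (suc m)

sumUpToℤ-cong : ∀ m {f g : ℕ → ℤ} → (∀ i → f i ≡ g i) → sumUpToℤ m f ≡ sumUpToℤ m g
sumUpToℤ-cong zero    eq = eq 0
sumUpToℤ-cong (suc m) eq = cong₂ _+_ (sumUpToℤ-cong m eq) (eq (suc m))

sumUpToℤ-distrib-+ : ∀ m (f g : ℕ → ℤ) → sumUpToℤ m (λ i → f i + g i) ≡ sumUpToℤ m f + sumUpToℤ m g
sumUpToℤ-distrib-+ zero    f g = refl
sumUpToℤ-distrib-+ (suc m) f g =
  trans (cong (_+ (f (suc m) + g (suc m))) (sumUpToℤ-distrib-+ m f g))
        (interchange (sumUpToℤ m f) (sumUpToℤ m g) (f (suc m)) (g (suc m)))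
  where
  interchange : ∀ a b c d → (a + b) + (c + d) ≡ (a + c) + (b + d)
  interchange = solve-∀

sumUpToℤ-distribˡ-* : ∀ m c (f : ℕ → ℤ) → sumUpToℤ m (λ i → c * f i) ≡ c * sumUpToℤ m f
sumUpToℤ-distribˡ-* zero    c f = refl
sumUpToℤ-distribˡ-* (suc m) c f =
  trans (cong (_+ c * f (suc m)) (sumUpToℤ-distribˡ-* m c f)) (sym (ℤₚ.*-distribˡ-+ c _ _))

sumUpToℤ-neg : ∀ m (f : ℕ → ℤ) → sumUpToℤ m (λ i → - f i) ≡ - sumUpToℤ m f
sumUpToℤ-neg zero    f = refl
sumUpToℤ-neg (suc m) f =
  trans (cong (_+ - f (suc m)) (sumUpToℤ-neg m f)) (sym (ℤₚ.neg-distrib-+ (sumUpToℤ m f) (f (suc m))))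

sumUpToℤ-suc : ∀ m (f : ℕ → ℤ) → sumUpToℤ (suc m) f ≡ f 0 + sumUpToℤ m (f ∘ suc)
sumUpToℤ-suc zero    f = refl
sumUpToℤ-suc (suc m) f = trans (cong (_+ f (suc (suc m))) (sumUpToℤ-suc m f)) (ℤₚ.+-assoc (f 0) _ _)

h+h<1+2h : ∀ h → h ℕ.+ h < suc (2 ℕ.* h)
h+h<1+2h h = ℕ.s≤s (ℕₚ.≤-reflexive (cong (h ℕ.+_) (sym (ℕₚ.+-identityʳ h))))

sgn-suc : ∀ n → sgn (suc n) ≡ - sgn n
sgn-suc zero          = refl
sgn-suc (suc zero)    = refl
sgn-suc (suc (suc n)) = sgn-suc n

pos-^ : ∀ m n → + (m ℕ.^ n) ≡ (+ m) ^ n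
pos-^ m zero    = refl
pos-^ m (suc n) = trans (ℤₚ.pos-* m (m ℕ.^ n)) (cong (+ m *_) (pos-^ m n))

module _ (K : ℤ) where

  Δ : ℤ → ℤ → ℤ → ℤ
  Δ a b c = a - K * b + c

  -- convolve u v Q lists the coefficients of (x² − K x + 1)(u + v x + x² Q) from x² upwards.
  convolve : ℤ → ℤ → Poly → Poly
  convolve u v []      = Δ u v (+ 0) ∷ Δ v (+ 0) (+ 0) ∷ []
  convolve u v (q ∷ Q) = Δ u v q ∷ convolve v q Q

  length-convolve : ∀ u v Q → length (convolve u v Q) ≡ suc (suc (length Q))
  length-convolve u v []      = refl
  length-convolve u v (q ∷ Q) = cong suc (length-convolve v q Q)

  coeff-convolve : ∀ u v Q n → let c = coeff (u ∷ v ∷ Q) in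
                   coeff (convolve u v Q) n ≡ Δ (c n) (c (suc n)) (c (suc (suc n)))
  coeff-convolve u v []      zero          = refl
  coeff-convolve u v []      (suc zero)    = refl
  coeff-convolve u v []      (suc (suc n)) = cong (λ x → + 0 - x + + 0) (sym (ℤₚ.*-zeroʳ K))
  coeff-convolve u v (q ∷ Q) zero          = refl
  coeff-convolve u v (q ∷ Q) (suc n)       = coeff-convolve v q Q n

  coeff-quadPoly-* : ∀ Q n → let c = coeff (+ 0 ∷ + 0 ∷ Q) in
                     coeff (polyMul (quadPoly K) Q) n ≡ Δ (c n) (c (suc n)) (c (suc (suc n)))
  coeff-quadPoly-* Q zero = begin
    coeff (polyMul (quadPoly K) Q) 0  ≡⟨ coeff-polyMul-∷ (+ 1) (- K ∷ + 1 ∷ []) Q 0 ⟩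
    + 1 * coeff Q 0 + + 0             ≡⟨ Δ₀ K (coeff Q 0) ⟩
    Δ (+ 0) (+ 0) (coeff Q 0)         ∎
    where
    Δ₀ : ∀ k x → + 1 * x + + 0 ≡ + 0 - k * + 0 + x
    Δ₀ = solve-∀
  coeff-quadPoly-* Q (suc zero) = begin
    coeff (polyMul (quadPoly K) Q) 1
      ≡⟨ coeff-polyMul-∷ (+ 1) (- K ∷ + 1 ∷ []) Q 1 ⟩
    + 1 * coeff Q 1 + coeff (polyMul (- K ∷ + 1 ∷ []) Q) 0
      ≡⟨ cong (λ x → + 1 * coeff Q 1 + x) (coeff-polyMul-∷ (- K) [ + 1 ] Q 0) ⟩
    + 1 * coeff Q 1 + (- K * coeff Q 0 + + 0)
      ≡⟨ Δ₁ K (coeff Q 0) (coeff Q 1) ⟩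
    Δ (+ 0) (coeff Q 0) (coeff Q 1) ∎
    where
    Δ₁ : ∀ k x y → + 1 * y + (- k * x + + 0) ≡ + 0 - k * x + y
    Δ₁ = solve-∀
  coeff-quadPoly-* Q (suc (suc n)) = begin
    coeff (polyMul (quadPoly K) Q) (2 ℕ.+ n)
      ≡⟨ coeff-polyMul-∷ (+ 1) (- K ∷ + 1 ∷ []) Q (2 ℕ.+ n) ⟩
    + 1 * z + coeff (polyMul (- K ∷ + 1 ∷ []) Q) (suc n)
      ≡⟨ cong (λ t → + 1 * z + t) (coeff-polyMul-∷ (- K) [ + 1 ] Q (suc n)) ⟩
    + 1 * z + (- K * y + coeff (polyMul [ + 1 ] Q) n)
      ≡⟨ cong (λ t → + 1 * z + (- K * y + t)) (coeff-polyMul-∷ (+ 1) [] Q n) ⟩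
    + 1 * z + (- K * y + (+ 1 * x + coeff [ + 0 ] n))
      ≡⟨ cong (λ t → + 1 * z + (- K * y + (+ 1 * x + t))) (coeff-[0] n) ⟩
    + 1 * z + (- K * y + (+ 1 * x + + 0))
      ≡⟨ Δ₂ K x y z ⟩
    Δ x y z ∎
    where
    x = coeff Q n
    y = coeff Q (suc n)
    z = coeff Q (2 ℕ.+ n)
    Δ₂ : ∀ k x y z → + 1 * z + (- k * y + (+ 1 * x + + 0)) ≡ x - k * y + z
    Δ₂ = solve-∀

  quadPoly-*≡convolve : ∀ q Q → polyMul (quadPoly K) (q ∷ Q) ≡ convolve (+ 0) (+ 0) (q ∷ Q)
  quadPoly-*≡convolve q Q = coeff-injective
    (trans (length-polyMul (+ 1) (- K ∷ + 1 ∷ []) q Q) (sym (length-convolve (+ 0) (+ 0) (q ∷ Q))))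
    (λ n → trans (coeff-quadPoly-* (q ∷ Q) n) (sym (coeff-convolve (+ 0) (+ 0) (q ∷ Q) n)))

  Recurrent : (ℕ → ℤ) → Set
  Recurrent f = ∀ n → f (suc (suc n)) ≡ K * f (suc n) - f n

  Δ-recurrent : ∀ {f} → Recurrent f → ∀ n → Δ (f n) (f (suc n)) (f (suc (suc n))) ≡ + 0
  Δ-recurrent {f} rec n = trans (cong (Δ (f n) (f (suc n))) (rec n)) (cancel K (f n) (f (suc n)))
    where
    cancel : ∀ k a b → a - k * b + (k * b - a) ≡ + 0
    cancel = solve-∀

  Δ-recurrent-reversed : ∀ {f} → Recurrent f → ∀ n → Δ (f (suc (suc n))) (f (suc n)) (f n) ≡ + 0
  Δ-recurrent-reversed {f} rec n = trans (cong (λ x → Δ x (f (suc n)) (f n)) (rec n)) (cancel K (f n) (f (suc n)))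
    where
    cancel : ∀ k a b → (k * b - a) - k * b + a ≡ + 0
    cancel = solve-∀

  convolve-applyUpTo : ∀ {f} → Recurrent f → ∀ r rest →
    convolve (f 0) (f 1) (applyUpTo (f ∘ suc ∘ suc) r ++ rest) ≡ replicate r (+ 0) ++ convolve (f r) (f (suc r)) rest
  convolve-applyUpTo rec zero    rest = refl
  convolve-applyUpTo rec (suc r) rest = cong₂ _∷_ (Δ-recurrent rec 0) (convolve-applyUpTo (rec ∘ suc) r rest)

  convolve-applyDownFrom : ∀ {f} → Recurrent f → ∀ n →
    convolve (f (suc n)) (f n) (applyDownFrom f n) ≡ replicate n (+ 0) ++ convolve (f 1) (f 0) []
  convolve-applyDownFrom rec zero    = refl
  convolve-applyDownFrom rec (suc n) = cong₂ _∷_ (Δ-recurrent-reversed rec n) (convolve-applyDownFrom rec n)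

  w : ℕ → ℤ
  w n = seqA K (suc n)

  w-recurrent : Recurrent w
  w-recurrent n = refl

  cofactor : ℕ → Poly
  cofactor j = applyUpTo (w ∘ suc) (suc j) ++ applyDownFrom (w ∘ suc) j

  cofactor-palindromic : ∀ j → Palindromic (cofactor j)
  cofactor-palindromic = applyUpTo-++-applyDownFrom-palindromic (w ∘ suc)

  cofactor-⊆-seqA : ∀ j → All (λ c → ∃ (λ i → NonZero i × seqA K i ≡ c)) (cofactor j)
  cofactor-⊆-seqA j = ++⁺ (applyUpTo⁺₂ (w ∘ suc) (suc j) value) (applyDownFrom⁺₂ (w ∘ suc) j value)
    where
    value : ∀ i → ∃ (λ n → NonZero n × seqA K n ≡ w (suc i))
    value i = suc (suc i) , _ , refl

  Δ[1,0,0] : Δ (+ 1) (+ 0) (+ 0) ≡ + 1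
  Δ[1,0,0] = cong (λ x → + 1 - x + + 0) (ℤₚ.*-zeroʳ K)

  convolve-peak : ∀ j → convolve (w j) (w (suc j)) (applyDownFrom (w ∘ suc) j)
                        ≡ - (w (suc (suc j)) - w j) ∷ replicate j (+ 0) ++ [ + 1 ]
  convolve-peak zero = cong₂ _∷_ (peak K) (cong [_] Δ[1,0,0])
    where
    peak : ∀ k → + 0 - k * + 1 + + 0 ≡ - (k * + 1 - + 0 - + 0)
    peak = solve-∀
  convolve-peak (suc j) = cong₂ _∷_ (peak K (w (suc j)) (w (suc (suc j)))) (begin
    convolve (w (suc (suc j))) (w (suc j)) (applyDownFrom (w ∘ suc) j)
      ≡⟨ convolve-applyDownFrom (w-recurrent ∘ suc) j ⟩
    replicate j (+ 0) ++ Δ (w 2) (w 1) (w 0) ∷ Δ (w 1) (+ 0) (+ 0) ∷ []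
      ≡⟨ cong₂ (λ x y → replicate j (+ 0) ++ x ∷ [ y ]) (Δ-recurrent-reversed w-recurrent 0) Δ[1,0,0] ⟩
    replicate j (+ 0) ++ + 0 ∷ [ + 1 ]
      ≡⟨ replicate-++-∷ j (+ 0) [ + 1 ] ⟩
    replicate (suc j) (+ 0) ++ [ + 1 ] ∎)
    where
    peak : ∀ k a b → a - k * b + a ≡ - ((k * b - a) - a)
    peak = solve-∀

  quadPoly-*-cofactor : ∀ j → polyMul (quadPoly K) (cofactor j) ≡ targetPoly (suc j) (w (suc (suc j)) - w j)
  quadPoly-*-cofactor j = begin
    polyMul (quadPoly K) (cofactor j)
      ≡⟨ quadPoly-*≡convolve (w 1) _ ⟩
    Δ (+ 0) (+ 0) (+ 1) ∷ convolve (w 0) (w 1) (applyUpTo (w ∘ suc ∘ suc) j ++ applyDownFrom (w ∘ suc) j)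
      ≡⟨ cong₂ _∷_ (cong (λ x → + 0 - x + + 1) (ℤₚ.*-zeroʳ K)) (convolve-applyUpTo w-recurrent j _) ⟩
    + 1 ∷ replicate j (+ 0) ++ convolve (w j) (w (suc j)) (applyDownFrom (w ∘ suc) j)
      ≡⟨ cong (λ x → + 1 ∷ replicate j (+ 0) ++ x) (convolve-peak j) ⟩
    targetPoly (suc j) (w (suc (suc j)) - w j) ∎

  monomial : ℕ → ℕ → ℕ → ℤ
  monomial s c e = sgn s * + c * K ^ e

  monomial-cong : ∀ {s s′ c c′ e e′} → s ≡ s′ → c ≡ c′ → e ≡ e′ → monomial s c e ≡ monomial s′ c′ e′
  monomial-cong refl refl refl = refl

  monomial-zero : ∀ s e → monomial s 0 e ≡ + 0
  monomial-zero s e = trans (cong (_* K ^ e) (ℤₚ.*-zeroʳ (sgn s))) (ℤₚ.*-zeroˡ (K ^ e))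

  monomial-suc : ∀ s c e → monomial (suc s) c e ≡ - monomial s c e
  monomial-suc s c e = begin
    sgn (suc s) * + c * K ^ e  ≡⟨ cong (λ x → x * + c * K ^ e) (sgn-suc s) ⟩
    - sgn s * + c * K ^ e      ≡⟨ cong (_* K ^ e) (ℤₚ.neg-distribˡ-* (sgn s) (+ c)) ⟨
    - (sgn s * + c) * K ^ e    ≡⟨ ℤₚ.neg-distribˡ-* (sgn s * + c) (K ^ e) ⟨
    - monomial s c e           ∎

  monomial-+ : ∀ s a b e → monomial s (a ℕ.+ b) (suc e) ≡ K * monomial s a e + monomial s b (suc e)
  monomial-+ s a b e = trans (cong (λ x → sgn s * x * K ^ suc e) (ℤₚ.pos-+ a b)) (distrib K (sgn s) (+ a) (+ b) (K ^ e))
    where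
    distrib : ∀ k σ x y z → σ * (x + y) * (k * z) ≡ k * (σ * x * z) + σ * y * (k * z)
    distrib = solve-∀

  evenTerm oddTerm oddTerm′ : ℕ → ℕ → ℤ
  evenTerm h i = monomial (i ℕ.+ h) ((i ℕ.+ h) C (2 ℕ.* i)) (2 ℕ.* i)
  oddTerm  h i = monomial (i ℕ.+ h) (suc (i ℕ.+ h) C suc (2 ℕ.* i)) (suc (2 ℕ.* i))
  oddTerm′ h i = monomial (i ℕ.+ h) ((i ℕ.+ h) C suc (2 ℕ.* i)) (suc (2 ℕ.* i))

  evenTerm-zero : ∀ h → evenTerm h 0 ≡ sgn h
  evenTerm-zero h = trans (ℤₚ.*-identityʳ (sgn h * + 1)) (ℤₚ.*-identityʳ (sgn h))

  evenTerm-beyond : ∀ h → evenTerm h (suc h) ≡ + 0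
  evenTerm-beyond h = trans (cong (λ c → monomial (suc h ℕ.+ h) c (2 ℕ.* suc h)) (k>n⇒nCk≡0 lt))
                            (monomial-zero (suc h ℕ.+ h) (2 ℕ.* suc h))
    where
    lt : suc h ℕ.+ h < 2 ℕ.* suc h
    lt = subst (suc (h ℕ.+ h) <_) (sym (ℕₚ.*-suc 2 h)) (ℕ.s<s (h+h<1+2h h))

  oddTerm′-diagonal : ∀ h → oddTerm′ h h ≡ + 0
  oddTerm′-diagonal h = trans (cong (λ c → monomial (h ℕ.+ h) c (suc (2 ℕ.* h))) (k>n⇒nCk≡0 (h+h<1+2h h)))
                              (monomial-zero (h ℕ.+ h) (suc (2 ℕ.* h)))

  oddTerm-pascal : ∀ h i → oddTerm h i ≡ K * evenTerm h i + oddTerm′ h i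
  oddTerm-pascal h i = trans (cong (λ c → monomial (i ℕ.+ h) c (suc (2 ℕ.* i))) (sym (pascal (i ℕ.+ h) (2 ℕ.* i))))
                             (monomial-+ (i ℕ.+ h) ((i ℕ.+ h) C (2 ℕ.* i)) ((i ℕ.+ h) C suc (2 ℕ.* i)) (2 ℕ.* i))

  evenTerm-pascal : ∀ h i → evenTerm (suc h) (suc i) ≡ K * oddTerm h i - evenTerm h (suc i)
  evenTerm-pascal h i = begin
    evenTerm (suc h) (suc i)
      ≡⟨ monomial-cong (cong suc s≡) (cong₂ _C_ (cong suc s≡) e≡) e≡ ⟩
    monomial (2 ℕ.+ n) ((2 ℕ.+ n) C (2 ℕ.+ k)) (2 ℕ.+ k)
      ≡⟨ cong (λ c → monomial (2 ℕ.+ n) c (2 ℕ.+ k)) (pascal (suc n) (suc k)) ⟨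
    monomial (2 ℕ.+ n) (suc n C suc k ℕ.+ suc n C (2 ℕ.+ k)) (2 ℕ.+ k)
      ≡⟨ monomial-+ (2 ℕ.+ n) (suc n C suc k) (suc n C (2 ℕ.+ k)) (suc k) ⟩
    K * oddTerm h i + monomial (2 ℕ.+ n) (suc n C (2 ℕ.+ k)) (2 ℕ.+ k)
      ≡⟨ cong (_+_ (K * oddTerm h i)) (monomial-suc (suc n) (suc n C (2 ℕ.+ k)) (2 ℕ.+ k)) ⟩
    K * oddTerm h i - monomial (suc n) (suc n C (2 ℕ.+ k)) (2 ℕ.+ k)
      ≡⟨ cong (λ x → K * oddTerm h i - x) (monomial-cong {s = suc n} refl (cong (suc n C_) (sym e≡)) (sym e≡)) ⟩
    K * oddTerm h i - evenTerm h (suc i) ∎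
    where
    n = i ℕ.+ h
    k = 2 ℕ.* i
    s≡ : i ℕ.+ suc h ≡ suc n
    s≡ = ℕₚ.+-suc i h
    e≡ : 2 ℕ.* suc i ≡ 2 ℕ.+ k
    e≡ = ℕₚ.*-suc 2 i

  oddTerm′-suc : ∀ h i → oddTerm′ (suc h) i ≡ - oddTerm h i
  oddTerm′-suc h i = trans (monomial-cong {e = suc (2 ℕ.* i)} s≡ (cong (_C suc (2 ℕ.* i)) s≡) refl)
                         (monomial-suc (i ℕ.+ h) (suc (i ℕ.+ h) C suc (2 ℕ.* i)) (suc (2 ℕ.* i)))
    where
    s≡ : i ℕ.+ suc h ≡ suc (i ℕ.+ h)
    s≡ = ℕₚ.+-suc i h

  evenSum-unfold : ∀ h → sumUpToℤ h (evenTerm h) ≡ sgn h + sumUpToℤ h (λ i → evenTerm h (suc i))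
  evenSum-unfold h = begin
    sumUpToℤ h (evenTerm h)
      ≡⟨ ℤₚ.+-identityʳ _ ⟨
    sumUpToℤ h (evenTerm h) + + 0
      ≡⟨ cong (_+_ (sumUpToℤ h (evenTerm h))) (evenTerm-beyond h) ⟨
    sumUpToℤ (suc h) (evenTerm h)
      ≡⟨ sumUpToℤ-suc h (evenTerm h) ⟩
    evenTerm h 0 + sumUpToℤ h (λ i → evenTerm h (suc i))
      ≡⟨ cong (_+ sumUpToℤ h (λ i → evenTerm h (suc i))) (evenTerm-zero h) ⟩
    sgn h + sumUpToℤ h (λ i → evenTerm h (suc i)) ∎

  evenSum-suc : ∀ h → sumUpToℤ (suc h) (evenTerm (suc h)) ≡ K * sumUpToℤ h (oddTerm h) - sumUpToℤ h (evenTerm h)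
  evenSum-suc h = begin
    sumUpToℤ (suc h) (evenTerm (suc h))
      ≡⟨ sumUpToℤ-suc h (evenTerm (suc h)) ⟩
    evenTerm (suc h) 0 + sumUpToℤ h (λ i → evenTerm (suc h) (suc i))
      ≡⟨ cong₂ _+_ (trans (evenTerm-zero (suc h)) (sgn-suc h)) (sumUpToℤ-cong h (evenTerm-pascal h)) ⟩
    - sgn h + sumUpToℤ h (λ i → K * oddTerm h i - evenTerm h (suc i))
      ≡⟨ cong (_+_ (- sgn h)) (sumUpToℤ-distrib-+ h (λ i → K * oddTerm h i) (λ i → - evenTerm h (suc i))) ⟩
    - sgn h + (sumUpToℤ h (λ i → K * oddTerm h i) + sumUpToℤ h (λ i → - evenTerm h (suc i)))
      ≡⟨ cong (_+_ (- sgn h)) (cong₂ _+_ (sumUpToℤ-distribˡ-* h K (oddTerm h))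
                                        (sumUpToℤ-neg h (λ i → evenTerm h (suc i)))) ⟩
    - sgn h + (K * sumUpToℤ h (oddTerm h) - sumUpToℤ h (λ i → evenTerm h (suc i)))
      ≡⟨ regroup (sgn h) (K * sumUpToℤ h (oddTerm h)) (sumUpToℤ h (λ i → evenTerm h (suc i))) ⟩
    K * sumUpToℤ h (oddTerm h) - (sgn h + sumUpToℤ h (λ i → evenTerm h (suc i)))
      ≡⟨ cong (λ x → K * sumUpToℤ h (oddTerm h) - x) (evenSum-unfold h) ⟨
    K * sumUpToℤ h (oddTerm h) - sumUpToℤ h (evenTerm h) ∎
    where
    regroup : ∀ σ a b → - σ + (a - b) ≡ a - (σ + b)
    regroup = solve-∀

  oddSum-split : ∀ h → sumUpToℤ h (oddTerm h) ≡ K * sumUpToℤ h (evenTerm h) + sumUpToℤ h (oddTerm′ h)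
  oddSum-split h = begin
    sumUpToℤ h (oddTerm h)
      ≡⟨ sumUpToℤ-cong h (oddTerm-pascal h) ⟩
    sumUpToℤ h (λ i → K * evenTerm h i + oddTerm′ h i)
      ≡⟨ sumUpToℤ-distrib-+ h (λ i → K * evenTerm h i) (oddTerm′ h) ⟩
    sumUpToℤ h (λ i → K * evenTerm h i) + sumUpToℤ h (oddTerm′ h)
      ≡⟨ cong (_+ sumUpToℤ h (oddTerm′ h)) (sumUpToℤ-distribˡ-* h K (evenTerm h)) ⟩
    K * sumUpToℤ h (evenTerm h) + sumUpToℤ h (oddTerm′ h) ∎

  oddSum′-suc : ∀ h → sumUpToℤ (suc h) (oddTerm′ (suc h)) ≡ - sumUpToℤ h (oddTerm h)
  oddSum′-suc h = begin
    sumUpToℤ h (oddTerm′ (suc h)) + oddTerm′ (suc h) (suc h)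
      ≡⟨ cong (_+_ (sumUpToℤ h (oddTerm′ (suc h)))) (oddTerm′-diagonal (suc h)) ⟩
    sumUpToℤ h (oddTerm′ (suc h)) + + 0
      ≡⟨ ℤₚ.+-identityʳ _ ⟩
    sumUpToℤ h (oddTerm′ (suc h))
      ≡⟨ sumUpToℤ-cong h (oddTerm′-suc h) ⟩
    sumUpToℤ h (λ i → - oddTerm h i)
      ≡⟨ sumUpToℤ-neg h (oddTerm h) ⟩
    - sumUpToℤ h (oddTerm h) ∎

  evenSum≡w : ∀ h → sumUpToℤ h (evenTerm h) ≡ w (suc (2 ℕ.* h))
  oddSum≡w : ∀ h → sumUpToℤ h (oddTerm h) ≡ w (suc (suc (2 ℕ.* h)))
  oddSum′≡-w : ∀ h → sumUpToℤ h (oddTerm′ h) ≡ - w (2 ℕ.* h)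

  evenSum≡w zero    = refl
  evenSum≡w (suc h) = begin
    sumUpToℤ (suc h) (evenTerm (suc h))
      ≡⟨ evenSum-suc h ⟩
    K * sumUpToℤ h (oddTerm h) - sumUpToℤ h (evenTerm h)
      ≡⟨ cong₂ (λ a b → K * a - b) (oddSum≡w h) (evenSum≡w h) ⟩
    w (3 ℕ.+ 2 ℕ.* h)
      ≡⟨ cong (w ∘ suc) (ℕₚ.*-suc 2 h) ⟨
    w (suc (2 ℕ.* suc h)) ∎

  oddSum≡w h = begin
    sumUpToℤ h (oddTerm h)
      ≡⟨ oddSum-split h ⟩
    K * sumUpToℤ h (evenTerm h) + sumUpToℤ h (oddTerm′ h)
      ≡⟨ cong₂ (λ a b → K * a + b) (evenSum≡w h) (oddSum′≡-w h) ⟩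
    w (suc (suc (2 ℕ.* h))) ∎

  oddSum′≡-w zero    = oddTerm′-diagonal 0
  oddSum′≡-w (suc h) = begin
    sumUpToℤ (suc h) (oddTerm′ (suc h))  ≡⟨ oddSum′-suc h ⟩
    - sumUpToℤ h (oddTerm h)             ≡⟨ cong -_ (oddSum≡w h) ⟩
    - w (2 ℕ.+ 2 ℕ.* h)                  ≡⟨ cong (-_ ∘ w) (ℕₚ.*-suc 2 h) ⟨
    - w (2 ℕ.* suc h)                    ∎

toℚᵘ-fromℤ : ∀ z → ℚ.toℚᵘ (fromℤ z) ℚᵘ.≃ mkℚᵘ z 0
toℚᵘ-fromℤ z = ℚₚ.toℚᵘ-fromℚᵘ (mkℚᵘ z 0)

fromℤ-+ : ∀ a b → fromℤ (a + b) ≡ fromℤ a ℚ.+ fromℤ b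
fromℤ-+ a b = ℚₚ.toℚᵘ-injective (begin-≃
  ℚ.toℚᵘ (fromℤ (a + b))                        ≈⟨ toℚᵘ-fromℤ (a + b) ⟩
  mkℚᵘ (a + b) 0                                ≈⟨ *≡* (sums a b) ⟩
  mkℚᵘ a 0 ℚᵘ.+ mkℚᵘ b 0                        ≈⟨ ℚᵘₚ.+-cong (toℚᵘ-fromℤ a) (toℚᵘ-fromℤ b) ⟨
  ℚ.toℚᵘ (fromℤ a) ℚᵘ.+ ℚ.toℚᵘ (fromℤ b)        ≈⟨ ℚₚ.toℚᵘ-homo-+ (fromℤ a) (fromℤ b) ⟨
  ℚ.toℚᵘ (fromℤ a ℚ.+ fromℤ b)                  ∎≃)
  where
  open ℚᵘₚ.≃-Reasoning using (step-≈-⟩; step-≈-⟨) renaming (begin_ to begin-≃_; _∎ to _∎≃)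
  sums : ∀ a b → (a + b) * + 1 ≡ (a * + 1 + b * + 1) * + 1
  sums = solve-∀

fromℤ-* : ∀ a b → fromℤ (a * b) ≡ fromℤ a ℚ.* fromℤ b
fromℤ-* a b = ℚₚ.toℚᵘ-injective (begin-≃
  ℚ.toℚᵘ (fromℤ (a * b))                        ≈⟨ toℚᵘ-fromℤ (a * b) ⟩
  mkℚᵘ a 0 ℚᵘ.* mkℚᵘ b 0                        ≈⟨ ℚᵘₚ.*-cong (toℚᵘ-fromℤ a) (toℚᵘ-fromℤ b) ⟨
  ℚ.toℚᵘ (fromℤ a) ℚᵘ.* ℚ.toℚᵘ (fromℤ b)        ≈⟨ ℚₚ.toℚᵘ-homo-* (fromℤ a) (fromℤ b) ⟨
  ℚ.toℚᵘ (fromℤ a ℚ.* fromℤ b)                  ∎≃)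
  where
  open ℚᵘₚ.≃-Reasoning using (step-≈-⟩; step-≈-⟨) renaming (begin_ to begin-≃_; _∎ to _∎≃)

/-*-fromℤ : ∀ p d c m → p ℕ.* c ≡ suc d ℕ.* m → (+ p / suc d) ℚ.* fromℤ (+ c) ≡ fromℤ (+ m)
/-*-fromℤ p d c m pc≡dm = ℚₚ.toℚᵘ-injective (begin-≃
  ℚ.toℚᵘ ((+ p / suc d) ℚ.* fromℤ (+ c))             ≈⟨ ℚₚ.toℚᵘ-homo-* (+ p / suc d) (fromℤ (+ c)) ⟩
  ℚ.toℚᵘ (+ p / suc d) ℚᵘ.* ℚ.toℚᵘ (fromℤ (+ c))     ≈⟨ ℚᵘₚ.*-cong (ℚₚ.toℚᵘ-fromℚᵘ (mkℚᵘ (+ p) d))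
                                                                   (toℚᵘ-fromℤ (+ c)) ⟩
  mkℚᵘ (+ p) d ℚᵘ.* mkℚᵘ (+ c) 0                     ≈⟨ *≡* cross ⟩
  mkℚᵘ (+ m) 0                                       ≈⟨ toℚᵘ-fromℤ (+ m) ⟨
  ℚ.toℚᵘ (fromℤ (+ m))                               ∎≃)
  where
  open ℚᵘₚ.≃-Reasoning using (step-≈-⟩; step-≈-⟨) renaming (begin_ to begin-≃_; _∎ to _∎≃)
  cross : + p * + c * + 1 ≡ + m * + suc (d ℕ.* 1)
  cross = begin
    + p * + c * + 1          ≡⟨ ℤₚ.*-identityʳ (+ p * + c) ⟩
    + p * + c                ≡⟨ ℤₚ.pos-* p c ⟨
    + (p ℕ.* c)              ≡⟨ cong +_ (trans pc≡dm (ℕₚ.*-comm (suc d) m)) ⟩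
    + (m ℕ.* suc d)          ≡⟨ ℤₚ.pos-* m (suc d) ⟩
    + m * + suc d            ≡⟨ cong (λ e → + m * + suc e) (ℕₚ.*-identityʳ d) ⟨
    + m * + suc (d ℕ.* 1)    ∎

sumUpTo-fromℤ : ∀ m {g : ℕ → ℚ} {f : ℕ → ℤ} → (∀ i → g i ≡ fromℤ (f i)) →
                sumUpTo m g ≡ fromℤ (sumUpToℤ m f)
sumUpTo-fromℤ zero    eq = eq 0
sumUpTo-fromℤ (suc m) {f = f} eq =
  trans (cong₂ ℚ._+_ (sumUpTo-fromℤ m eq) (eq (suc m))) (sym (fromℤ-+ (sumUpToℤ m f) (f (suc m))))

-- The summand of Aval p k, with the upper limit h of the sum made a parameter.
avalTerm : ℕ → ℕ → ℕ → ℕ → ℚ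
avalTerm p h k i = fromℤ (sgn (i ℕ.+ h))
                   ℚ.* ((+ p) / suc (2 ℕ.* i))
                   ℚ.* fromℤ (+ ((i ℕ.+ h) C (2 ℕ.* i)))
                   ℚ.* fromℤ (+ (k ℕ.^ (2 ℕ.* i ℕ.+ 1)))

avalTerm-split : ∀ h k i → avalTerm (suc (2 ℕ.* h)) h k i ≡ fromℤ (oddTerm (+ k) h i + oddTerm′ (+ k) h i)
avalTerm-split h k i = begin
  σ ℚ.* q ℚ.* fromℤ (+ c) ℚ.* κ
    ≡⟨ cong (ℚ._* κ) (ℚₚ.*-assoc σ q (fromℤ (+ c))) ⟩
  σ ℚ.* (q ℚ.* fromℤ (+ c)) ℚ.* κ
    ≡⟨ cong (λ x → σ ℚ.* x ℚ.* κ) (/-*-fromℤ (suc (2 ℕ.* h)) (2 ℕ.* i) c (a ℕ.+ b) (binomial-split h i)) ⟩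
  σ ℚ.* fromℤ (+ (a ℕ.+ b)) ℚ.* κ
    ≡⟨ trans (fromℤ-* (sgn s * + (a ℕ.+ b)) (+ (k ℕ.^ e))) (cong (ℚ._* κ) (fromℤ-* (sgn s) (+ (a ℕ.+ b)))) ⟨
  fromℤ (sgn s * + (a ℕ.+ b) * + (k ℕ.^ e))
    ≡⟨ cong (λ x → fromℤ (sgn s * x * + (k ℕ.^ e))) (ℤₚ.pos-+ a b) ⟩
  fromℤ (sgn s * (+ a + + b) * + (k ℕ.^ e))
    ≡⟨ cong (λ x → fromℤ (sgn s * (+ a + + b) * x)) power ⟩
  fromℤ (sgn s * (+ a + + b) * (+ k) ^ suc (2 ℕ.* i))
    ≡⟨ cong fromℤ (distrib (sgn s) (+ a) (+ b) ((+ k) ^ suc (2 ℕ.* i))) ⟩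
  fromℤ (oddTerm (+ k) h i + oddTerm′ (+ k) h i) ∎
  where
  s = i ℕ.+ h
  c = s C (2 ℕ.* i)
  a = suc s C suc (2 ℕ.* i)
  b = s C suc (2 ℕ.* i)
  e = 2 ℕ.* i ℕ.+ 1
  σ = fromℤ (sgn s)
  q = (+ suc (2 ℕ.* h)) / suc (2 ℕ.* i)
  κ = fromℤ (+ (k ℕ.^ e))
  power : + (k ℕ.^ e) ≡ (+ k) ^ suc (2 ℕ.* i)
  power = trans (pos-^ k e) (cong ((+ k) ^_) (ℕₚ.+-comm (2 ℕ.* i) 1))
  distrib : ∀ σ x y z → σ * (x + y) * z ≡ σ * x * z + σ * y * z
  distrib = solve-∀

Aval-odd : ∀ h k → Aval (suc (2 ℕ.* h)) k ≡ fromℤ (w (+ k) (suc (suc (2 ℕ.* h))) - w (+ k) (2 ℕ.* h))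
Aval-odd h k = begin
  Aval (suc (2 ℕ.* h)) k
    ≡⟨ cong (λ h′ → sumUpTo h′ (avalTerm (suc (2 ℕ.* h)) h′ k)) half ⟩
  sumUpTo h (avalTerm (suc (2 ℕ.* h)) h k)
    ≡⟨ sumUpTo-fromℤ h (avalTerm-split h k) ⟩
  fromℤ (sumUpToℤ h (λ i → oddTerm K h i + oddTerm′ K h i))
    ≡⟨ cong fromℤ (sumUpToℤ-distrib-+ h (oddTerm K h) (oddTerm′ K h)) ⟩
  fromℤ (sumUpToℤ h (oddTerm K h) + sumUpToℤ h (oddTerm′ K h))
    ≡⟨ cong fromℤ (cong₂ _+_ (oddSum≡w K h) (oddSum′≡-w K h)) ⟩
  fromℤ (w K (suc (suc (2 ℕ.* h))) - w K (2 ℕ.* h)) ∎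
  where
  K = + k
  half : 2 ℕ.* h ℕ./ 2 ≡ h
  half = trans (cong (ℕ._/ 2) (ℕₚ.*-comm 2 h)) (m*n/n≡m h 2)

odd-or-even : ∀ n → ∃ (λ h → n ≡ suc (2 ℕ.* h)) ⊎ ∃ (λ h → n ≡ 2 ℕ.* h)
odd-or-even zero    = inj₂ (0 , refl)
odd-or-even (suc n) with odd-or-even n
... | inj₁ (h , refl) = inj₂ (suc h , sym (ℕₚ.*-suc 2 h))
... | inj₂ (h , refl) = inj₁ (h , refl)

prime≢2⇒odd : ∀ {p} → Prime p → p ≢ 2 → ∃ (λ h → p ≡ suc (2 ℕ.* h))
prime≢2⇒odd {p} p-prime p≢2 with odd-or-even p
... | inj₁ odd           = odd
... | inj₂ (h , refl) with prime⇒irreducible p-prime (divides h (ℕₚ.*-comm 2 h))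
...   | inj₁ ()
...   | inj₂ 2≡p = ⊥-elim (p≢2 (sym 2≡p))

theorem1 : (p k : ℕ) → Prime p → p ≢ 2 → NonZero k →
    Σ ℤ (λ A → fromℤ A ≡ Aval p k ×
    Σ Poly (λ Q →
    polyMul (quadPoly (+ k)) Q ≡ targetPoly p A
    × Palindromic Q
    × All (λ c → ∃ (λ i → NonZero i × seqA (+ k) i ≡ c)) Q))
theorem1 p k p-prime p≢2 _ with prime≢2⇒odd p-prime p≢2
... | h , refl =
  w (+ k) (suc (suc j)) - w (+ k) j , sym (Aval-odd h k) ,
  cofactor (+ k) j , quadPoly-*-cofactor (+ k) j , cofactor-palindromic (+ k) j , cofactor-⊆-seqA (+ k) j
  where
  j = 2 ℕ.* h
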